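{- Let $\Gamma$ be an AGW graph, let $S$ be a spanning subgraph of $\Gamma$, and let $N$ be the set of vertices of level $n$ (for some $n\ge 0$) from some tree of $S$. Consider a coloring of $\Gamma$ in which all edges of $S$ have the same color $\alpha$. Then every $F$-clique $F$ of the resulting automaton satisfies $|F\cap N|\le 1$.
   Context: An AGW graph is a finite directed strongly connected graph (multiple edges allowed) in which all vertices have the same outdegree $k$, and the greatest common divisor of the lengths of all its cycles is $1$. A spanning subgraph $S$ of $\Gamma$ is a subgraph containing all vertices of $\Gamma$ and exactly one outgoing edge of every vertex; it consists of disjoint cycles together with trees hanging on them. A tree of $S$ is a maximal subtree of $S$ whose root lies on a cycle of $S$ and which has no common edges with the cycles of $S$. The level of a vertex $\mathbf p$ in $S$ is the length of the path from $\mathbf p$ along edges of its tree to the root of the tree (vertices on cycles of $S$ have level $0$). A coloring assigns to the edges letters from an alphabet $\Sigma$ with $|\Sigma|=k$ so that the outgoing edges of each vertex receive distinct letters, giving a deterministic complete automaton; $\mathbf p s$ is the end of the path from $\mathbf p$ labeled $s\in\Sigma^+$, $Ps=\{\mathbf ps:\mathbf p\in P\}$, and $\Gamma s$ is the image of the whole vertex set. A pair of distinct states $\mathbf p,\mathbf q$ is a deadlock if $\mathbf p s\neq\mathbf q s$ for all $s\in\Sigma^+$. An $F$-clique is a set $\Gamma s$, $s\in\Sigma^+$, in which every pair of distinct states is a deadlock. -}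

module Defs where

open import Data.Nat using (ℕ; zero; suc; _<_)
open import Data.Nat.Divisibility using (_∣_)
open import Data.Fin using (Fin)
open import Data.List using (List; []; _∷_; length)
open import Data.Product using (Σ; ∃; _×_; _,_)
open import Relation.Binary.PropositionalEquality using (_≡_; _≢_)
open import Relation.Nullary using (¬_)
open import Function.Bundles using (_↔_; Inverse)

-- A finite directed multigraph on vertex set Fin m in which every vertex
-- has outdegree exactly k: the outgoing edges of p are indexed by Fin k,
-- and edge p e is the end of the e-th outgoing edge of p.
record Graph (m k : ℕ) : Set where
  field
    edge : Fin m → Fin k → Fin m
open Graph public

walk : ∀ {m k} → Graph m k → Fin m → List (Fin k) → Fin m
walk Γ p []       = p
walk Γ p (e ∷ es) = walk Γ (edge Γ p e) es

StronglyConnected : ∀ {m k} → Graph m k → Set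
StronglyConnected Γ = ∀ p q → ∃ λ es → walk Γ p es ≡ q

IsCycle : ∀ {m k} → Graph m k → Fin m → List (Fin k) → Set
IsCycle Γ p es = (0 < length es) × (walk Γ p es ≡ p)

-- gcd of all cycle lengths is 1: the only common divisor of all cycle
-- lengths is 1.
CycleGcdOne : ∀ {m k} → Graph m k → Set
CycleGcdOne Γ = ∀ d → (∀ p es → IsCycle Γ p es → d ∣ length es) → d ≡ 1

record AGW {m k} (Γ : Graph m k) : Set where
  field
    strong : StronglyConnected Γ
    aperiodic : CycleGcdOne Γ

-- Spanning subgraph: exactly one outgoing edge chosen at each vertex.
Spanning : ℕ → ℕ → Set
Spanning m k = Fin m → Fin k

succS : ∀ {m k} → Graph m k → Spanning m k → Fin m → Fin m
succS Γ S p = edge Γ p (S p)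

iter : ∀ {m} → (Fin m → Fin m) → ℕ → Fin m → Fin m
iter f zero    p = p
iter f (suc n) p = iter f n (f p)

OnCycleS : ∀ {m k} → Graph m k → Spanning m k → Fin m → Set
OnCycleS Γ S p = ∃ λ j → (0 < j) × (iter (succS Γ S) j p ≡ p)

-- p has level n in S: the S-path from p first reaches a cycle of S after
-- n steps; its root is then iter (succS Γ S) n p.
HasLevel : ∀ {m k} → Graph m k → Spanning m k → Fin m → ℕ → Set
HasLevel Γ S p n =
  OnCycleS Γ S (iter (succS Γ S) n p) ×
  (∀ j → j < n → ¬ OnCycleS Γ S (iter (succS Γ S) j p))

InLevelOfTree : ∀ {m k} → Graph m k → Spanning m k → Fin m → ℕ → Fin m → Set
InLevelOfTree Γ S r n p = HasLevel Γ S p n × (iter (succS Γ S) n p ≡ r)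

-- A coloring: for each vertex, a bijection between its outgoing edges
-- (indexed by Fin k) and the letters Σ = Fin k.
Coloring : ℕ → ℕ → Set
Coloring m k = Fin m → (Fin k ↔ Fin k)

colorOf : ∀ {m k} → Coloring m k → Fin m → Fin k → Fin k
colorOf c p e = Inverse.to (c p) e

δ : ∀ {m k} → Graph m k → Coloring m k → Fin m → Fin k → Fin m
δ Γ c p a = edge Γ p (Inverse.from (c p) a)

δ* : ∀ {m k} → Graph m k → Coloring m k → Fin m → List (Fin k) → Fin m
δ* Γ c p []       = p
δ* Γ c p (a ∷ w)  = δ* Γ c (δ Γ c p a) w

NonEmpty : ∀ {k} → List (Fin k) → Set
NonEmpty w = 0 < length w

Deadlock : ∀ {m k} → Graph m k → Coloring m k → Fin m → Fin m → Set
Deadlock Γ c p q = p ≢ q × (∀ w → NonEmpty w → δ* Γ c p w ≢ δ* Γ c q w)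

-- membership in Γ w
InImage : ∀ {m k} → Graph m k → Coloring m k → List (Fin k) → Fin m → Set
InImage Γ c w q = ∃ λ p → δ* Γ c p w ≡ q

IsFClique : ∀ {m k} → Graph m k → Coloring m k → List (Fin k) → Set
IsFClique Γ c w =
  NonEmpty w ×
  (∀ p q → InImage Γ c w p → InImage Γ c w q → p ≢ q → Deadlock Γ c p q)

module Submission where

-- Since every edge of S carries the letter α, reading α
-- from a vertex follows its S-edge; hence reading α^j follows the
-- S-path for j steps.  Two vertices p, q of level n in the tree with
-- root r both reach r after n steps along S, so the word α^(n+1) sends
-- them to the same state (the S-successor of r).  In an F-clique any
-- two distinct states form a deadlock, i.e. no nonempty word
-- synchronises them; so p and q cannot be distinct.

open import Defs
open import Data.Nat using (ℕ; zero; suc; s≤s; z≤n)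
open import Data.Fin using (Fin; _≟_)
open import Data.List using (List; []; _∷_; replicate)
open import Data.Product using (_,_; proj₂)
open import Relation.Nullary using (yes; no; contradiction)
open import Function.Bundles using (Inverse)
open import Relation.Binary.PropositionalEquality
  using (_≡_; refl; sym; trans; cong; module ≡-Reasoning)

iter-suc : ∀ {m} (f : Fin m → Fin m) n p → iter f (suc n) p ≡ f (iter f n p)
iter-suc f zero    p = refl
iter-suc f (suc n) p = iter-suc f n (f p)

α-follows-S : ∀ {m k} (Γ : Graph m k) (S : Spanning m k) (c : Coloring m k) (α : Fin k)
            → (∀ p → colorOf c p (S p) ≡ α) → ∀ p → δ Γ c p α ≡ succS Γ S p
α-follows-S Γ S c α Sα p = cong (edge Γ p) (begin
    Inverse.from (c p) α                      ≡⟨ cong (Inverse.from (c p)) (sym (Sα p)) ⟩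
    Inverse.from (c p) (colorOf c p (S p))    ≡⟨ Inverse.strictlyInverseʳ (c p) (S p) ⟩
    S p                                       ∎)
  where open ≡-Reasoning

α-power-follows-S : ∀ {m k} (Γ : Graph m k) (S : Spanning m k) (c : Coloring m k) (α : Fin k)
                  → (∀ p → colorOf c p (S p) ≡ α)
                  → ∀ n p → δ* Γ c p (replicate n α) ≡ iter (succS Γ S) n p
α-power-follows-S Γ S c α Sα zero    p = refl
α-power-follows-S Γ S c α Sα (suc n) p
  rewrite α-follows-S Γ S c α Sα p = α-power-follows-S Γ S c α Sα n (succS Γ S p)

clique-synchronised⇒equal : ∀ {m k} (Γ : Graph m k) (c : Coloring m k) (w : List (Fin k))
                          → IsFClique Γ c w
                          → ∀ p q → InImage Γ c w p → InImage Γ c w q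
                          → (u : List (Fin k)) → NonEmpty u → δ* Γ c p u ≡ δ* Γ c q u
                          → p ≡ q
clique-synchronised⇒equal Γ c w (_ , deadlocks) p q p∈F q∈F u u≢[] sync with p ≟ q
... | yes p≡q = p≡q
... | no  p≢q = contradiction sync (proj₂ (deadlocks p q p∈F q∈F p≢q) u u≢[])

lemma5 : ∀ {m k} (Γ : Graph m k) → AGW Γ → (S : Spanning m k)
         → (r : Fin m) → OnCycleS Γ S r → (n : ℕ)
         → (c : Coloring m k) → (α : Fin k) → (∀ p → colorOf c p (S p) ≡ α)
         → (w : List (Fin k)) → IsFClique Γ c w
         → ∀ p q → InImage Γ c w p → InImage Γ c w q
         → InLevelOfTree Γ S r n p → InLevelOfTree Γ S r n q
         → p ≡ q
lemma5 {m} Γ _ S r _ n c α Sα w F p q p∈F q∈F (_ , p↦r) (_ , q↦r) =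
  clique-synchronised⇒equal Γ c w F p q p∈F q∈F (replicate (suc n) α) (s≤s z≤n) α^[n+1]-synchronises
  where
  open ≡-Reasoning
  f : Fin m → Fin m
  f = succS Γ S
  -- α^(n+1) sends both p and q to the S-successor of their common root r.
  α^[n+1]-synchronises : δ* Γ c p (replicate (suc n) α) ≡ δ* Γ c q (replicate (suc n) α)
  α^[n+1]-synchronises = begin
    δ* Γ c p (replicate (suc n) α)   ≡⟨ α-power-follows-S Γ S c α Sα (suc n) p ⟩
    iter f (suc n) p                 ≡⟨ iter-suc f n p ⟩
    f (iter f n p)                   ≡⟨ cong f (trans p↦r (sym q↦r)) ⟩
    f (iter f n q)                   ≡⟨ sym (iter-suc f n q) ⟩
    iter f (suc n) q                 ≡⟨ sym (α-power-follows-S Γ S c α Sα (suc n) q) ⟩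
    δ* Γ c q (replicate (suc n) α)   ∎
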